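{- Let $\mathbf{M}=\langle M,\preccurlyeq^{\mathbf{M}},F^{\mathbf{M}}\rangle$ be an algebra with $\mathbf{L}$-order and let $\theta$ be an $\mathbf{L}$-preorder compatible with $\mathbf{M}$. Put $\theta_\approx=\theta\cap\theta^{ -1}$, $M/\theta=\{[a]_\theta;\,a\in M\}$ where $[a]_\theta=\{b\in M;\,\theta_\approx(a,b)=1\}$, $f^{\mathbf{M}/\theta}([a_1]_\theta,\dots,[a_n]_\theta)=[f^{\mathbf{M}}(a_1,\dots,a_n)]_\theta$, $[a]_\theta\approx^{\mathbf{M}/\theta}[b]_\theta=\theta_\approx(a,b)$, and $$[a]_\theta\preccurlyeq^{\mathbf{M}/\theta}[b]_\theta=\theta(a,b).$$ Then $\preccurlyeq^{\mathbf{M}/\theta}$ is well defined (its value does not depend on the choice of representatives) and, with respect to $\approx^{\mathbf{M}/\theta}$, it satisfies: reflexivity ($x\preccurlyeq x=1$), $(x\preccurlyeq y)\wedge(y\preccurlyeq x)\le x\approx y$, $\otimes$-transitivity, $(x_1\approx y_1)\otimes(x_2\approx y_2)\le(x_1\preccurlyeq x_2)\rightarrow(y_1\preccurlyeq y_2)$, and compatibility with all $f^{\mathbf{M}/\theta}$. Consequently $\mathbf{M}/\theta=\langle M/\theta,\approx^{\mathbf{M}/\theta},\preccurlyeq^{\mathbf{M}/\theta},F^{\mathbf{M}/\theta}\rangle$ is a well-defined algebra with $\mathbf{L}$-order.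
   Context: $\mathbf{L}=\langle L,\wedge,\vee,\otimes,\rightarrow,0,1\rangle$ is a complete residuated lattice (complete lattice, commutative monoid $\langle L,\otimes,1\rangle$, $a\otimes b\le c$ iff $a\le b\rightarrow c$). $F$ is a type (function symbols with finite arities). A binary $\mathbf{L}$-relation on $M$ is a map $M\times M\to L$; $\theta^{ -1}(a,b)=\theta(b,a)$, $\cap$ is pointwise infimum, $\subseteq$ is pointwise $\le$. An algebra with $\mathbf{L}$-order of type $F$ is $\langle M,\preccurlyeq^{\mathbf{M}},F^{\mathbf{M}}\rangle$ where $\langle M,F^{\mathbf{M}}\rangle$ is an algebra of type $F$ and $\preccurlyeq^{\mathbf{M}}$ is a binary $\mathbf{L}$-relation with: $a\preccurlyeq^{\mathbf{M}}a=1$; $(a\preccurlyeq^{\mathbf{M}}b)\otimes(b\preccurlyeq^{\mathbf{M}}c)\le a\preccurlyeq^{\mathbf{M}}c$; $(a_1\preccurlyeq^{\mathbf{M}}b_1)\otimes\cdots\otimes(a_n\preccurlyeq^{\mathbf{M}}b_n)\le f^{\mathbf{M}}(a_1,\dots,a_n)\preccurlyeq^{\mathbf{M}}f^{\mathbf{M}}(b_1,\dots,b_n)$ for each $n$-ary $f\in F$; and $a\preccurlyeq^{\mathbf{M}}b=b\preccurlyeq^{\mathbf{M}}a=1$ implies $a=b$. Its $\mathbf{L}$-equality is $a\approx^{\mathbf{M}}b=(a\preccurlyeq^{\mathbf{M}}b)\wedge(b\preccurlyeq^{\mathbf{M}}a)$. (Equivalently, a structure $\langle M,\approx,\preccurlyeq,F^{\mathbf{M}}\rangle$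 with $\approx$ an $\mathbf{L}$-equality satisfying $a\approx b=1$ iff $a=b$, symmetry, $\otimes$-transitivity and compatibility with all functions, and $\preccurlyeq$ satisfying the five conditions listed in the claim.) An $\mathbf{L}$-preorder compatible with $\mathbf{M}$ is a binary $\mathbf{L}$-relation $\theta$ on $M$ with $\preccurlyeq^{\mathbf{M}}\subseteq\theta$, $\theta(a,b)\otimes\theta(b,c)\le\theta(a,c)$, and $\theta(a_1,b_1)\otimes\cdots\otimes\theta(a_n,b_n)\le\theta(f^{\mathbf{M}}(a_1,\dots,a_n),f^{\mathbf{M}}(b_1,\dots,b_n))$ for all $n$-ary $f\in F$. (It is known that $\theta_\approx$ is then an equivalence-like relation whose $1$-classes form a partition compatible with the operations, so $f^{\mathbf{M}/\theta}$ is well defined.) -}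

module Defs where

open import Level using (Level; _⊔_; suc)
open import Data.Nat using (ℕ; zero) renaming (suc to sucℕ)
open import Data.Fin using (Fin) renaming (zero to fz; suc to fs)
open import Data.Product using (_×_; _,_)
open import Relation.Binary.PropositionalEquality using (_≡_)
open import Function using (_∘_)

-- Complete residuated lattices
-- Index sets of arbitrary infima/suprema live in the same universe as L.

record CompleteResiduatedLattice (ℓ : Level) : Set (suc ℓ) where
  infixr 7 _⊗_
  infixr 6 _∧_
  infixr 5 _∨_
  infixr 4 _⇒_
  infix  3 _≤_
  field
    L    : Set ℓ
    _≤_  : L → L → Set ℓ
    _∧_  : L → L → L
    _∨_  : L → L → L
    _⊗_  : L → L → L
    _⇒_  : L → L → L
    ⋀    : {I : Set ℓ} → (I → L) → L
    ⋁    : {I : Set ℓ} → (I → L) → L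
    𝟘    : L
    𝟙    : L
    ≤-refl    : ∀ {a} → a ≤ a
    ≤-trans   : ∀ {a b c} → a ≤ b → b ≤ c → a ≤ c
    ≤-antisym : ∀ {a b} → a ≤ b → b ≤ a → a ≡ b
    ∧-lower₁  : ∀ a b → a ∧ b ≤ a
    ∧-lower₂  : ∀ a b → a ∧ b ≤ b
    ∧-greatest : ∀ {a b c} → c ≤ a → c ≤ b → c ≤ a ∧ b
    ∨-upper₁  : ∀ a b → a ≤ a ∨ b
    ∨-upper₂  : ∀ a b → b ≤ a ∨ b
    ∨-least   : ∀ {a b c} → a ≤ c → b ≤ c → a ∨ b ≤ c
    ⋀-lower    : ∀ {I : Set ℓ} (x : I → L) (i : I) → ⋀ x ≤ x i
    ⋀-greatest : ∀ {I : Set ℓ} (x : I → L) {c} → (∀ i → c ≤ x i) → c ≤ ⋀ x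
    ⋁-upper    : ∀ {I : Set ℓ} (x : I → L) (i : I) → x i ≤ ⋁ x
    ⋁-least    : ∀ {I : Set ℓ} (x : I → L) {c} → (∀ i → x i ≤ c) → ⋁ x ≤ c
    𝟘-least   : ∀ a → 𝟘 ≤ a
    𝟙-greatest : ∀ a → a ≤ 𝟙
    ⊗-assoc   : ∀ a b c → (a ⊗ b) ⊗ c ≡ a ⊗ (b ⊗ c)
    ⊗-comm    : ∀ a b → a ⊗ b ≡ b ⊗ a
    ⊗-identityʳ : ∀ a → a ⊗ 𝟙 ≡ a
    adj₁ : ∀ {a b c} → a ⊗ b ≤ c → a ≤ b ⇒ c
    adj₂ : ∀ {a b c} → a ≤ b ⇒ c → a ⊗ b ≤ c

record Type : Set₁ where
  field
    Sym   : Set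
    arity : Sym → ℕ

module _ {ℓ : Level} (𝐋 : CompleteResiduatedLattice ℓ) where
  open CompleteResiduatedLattice 𝐋

  LRel : ∀ {m} → Set m → Set (m ⊔ ℓ)
  LRel M = M → M → L

  big⊗ : ∀ {n} → (Fin n → L) → L
  big⊗ {zero}   _ = 𝟙
  big⊗ {sucℕ n} x = x fz ⊗ big⊗ (x ∘ fs)

  _⁻¹ : ∀ {m} {M : Set m} → LRel M → LRel M
  (θ ⁻¹) a b = θ b a

  _∩_ : ∀ {m} {M : Set m} → LRel M → LRel M → LRel M
  (θ ∩ ψ) a b = θ a b ∧ ψ a b

  _⊆_ : ∀ {m} {M : Set m} → LRel M → LRel M → Set (m ⊔ ℓ)
  θ ⊆ ψ = ∀ a b → θ a b ≤ ψ a b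

  record AlgebraWithLOrder (F : Type) (m : Level) : Set (suc (m ⊔ ℓ)) where
    open Type F
    field
      M    : Set m
      op   : (f : Sym) → (Fin (arity f) → M) → M
      _≼_  : LRel M
      ≼-refl    : ∀ a → (a ≼ a) ≡ 𝟙
      ≼-trans   : ∀ a b c → (a ≼ b) ⊗ (b ≼ c) ≤ (a ≼ c)
      ≼-compat  : ∀ (f : Sym) (a b : Fin (arity f) → M) →
                  big⊗ (λ i → a i ≼ b i) ≤ (op f a ≼ op f b)
      ≼-antisym : ∀ a b → (a ≼ b) ≡ 𝟙 → (b ≼ a) ≡ 𝟙 → a ≡ b

  record IsCompatibleLPreorder {F : Type} {m : Level}
         (𝐌 : AlgebraWithLOrder F m) (θ : LRel (AlgebraWithLOrder.M 𝐌)) : Set (m ⊔ ℓ) where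
    open Type F
    open AlgebraWithLOrder 𝐌
    field
      ≼⊆θ      : _≼_ ⊆ θ
      θ-trans  : ∀ a b c → θ a b ⊗ θ b c ≤ θ a c
      θ-compat : ∀ (f : Sym) (a b : Fin (arity f) → M) →
                 big⊗ (λ i → θ (a i) (b i)) ≤ θ (op f a) (op f b)

  -- Algebra with L-order in the equivalent presentation
  -- ⟨M, ≈, ≼, F⟩, over a carrier whose (crisp) equality is given as an
  -- equivalence relation _≐_ (needed since quotients are not types in Agda).
  record IsAlgebraWithLOrderEq (F : Type) {m e : Level} (M : Set m)
         (_≐_ : M → M → Set e)
         (op : (f : Type.Sym F) → (Fin (Type.arity F f) → M) → M)
         (_≈_ _≼_ : LRel M) : Set (m ⊔ e ⊔ ℓ) where
    open Type F
    field
      ≐-refl  : ∀ a → a ≐ a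
      ≐-sym   : ∀ {a b} → a ≐ b → b ≐ a
      ≐-trans : ∀ {a b c} → a ≐ b → b ≐ c → a ≐ c
      op-cong : ∀ (f : Sym) (a b : Fin (arity f) → M) →
                (∀ i → a i ≐ b i) → op f a ≐ op f b
      ≈-wd : ∀ {a a' b b'} → a ≐ a' → b ≐ b' → (a ≈ b) ≡ (a' ≈ b')
      ≼-wd : ∀ {a a' b b'} → a ≐ a' → b ≐ b' → (a ≼ b) ≡ (a' ≼ b')
      ≈-one⇒≐ : ∀ a b → (a ≈ b) ≡ 𝟙 → a ≐ b
      ≐⇒≈-one : ∀ a b → a ≐ b → (a ≈ b) ≡ 𝟙
      ≈-sym    : ∀ a b → (a ≈ b) ≡ (b ≈ a)
      ≈-trans  : ∀ a b c → (a ≈ b) ⊗ (b ≈ c) ≤ (a ≈ c)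
      ≈-compat : ∀ (f : Sym) (a b : Fin (arity f) → M) →
                 big⊗ (λ i → a i ≈ b i) ≤ (op f a ≈ op f b)
      ≼-refl    : ∀ a → (a ≼ a) ≡ 𝟙
      ≼-antisym : ∀ a b → (a ≼ b) ∧ (b ≼ a) ≤ (a ≈ b)
      ≼-trans   : ∀ a b c → (a ≼ b) ⊗ (b ≼ c) ≤ (a ≼ c)
      ≼-ext     : ∀ a₁ a₂ b₁ b₂ → (a₁ ≈ b₁) ⊗ (a₂ ≈ b₂) ≤ ((a₁ ≼ a₂) ⇒ (b₁ ≼ b₂))
      ≼-compat  : ∀ (f : Sym) (a b : Fin (arity f) → M) →
                  big⊗ (λ i → a i ≼ b i) ≤ (op f a ≼ op f b)

  -- the quotient M/θ, presented with carrier M and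
  -- [a]_θ = [b]_θ  iff  θ_≈(a,b) = 1
  module Quotient {F : Type} {m : Level} (𝐌 : AlgebraWithLOrder F m) (θ : LRel (AlgebraWithLOrder.M 𝐌)) where
    open AlgebraWithLOrder 𝐌 using (M; op)
    θ≈ : LRel M
    θ≈ = θ ∩ (θ ⁻¹)
    _≐θ_ : M → M → Set ℓ
    a ≐θ b = θ≈ a b ≡ 𝟙
    opθ : (f : Type.Sym F) → (Fin (Type.arity F f) → M) → M
    opθ = op
    _≈θ_ : LRel M
    _≈θ_ = θ≈
    _≼θ_ : LRel M
    _≼θ_ = θ

-- θ is reflexive and ⊗-transitive, so its 1-cut is a crisp preorder along which θ is
-- antitone in the first and monotone in the second argument; hence θ, and with it θ ∩ θ⁻¹,
-- is constant on 1-classes of θ ∩ θ⁻¹, and the extensionality law is two instances of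
-- ⊗-transitivity. Compatibility of θ ∩ θ⁻¹ and of the 1-classes with the operations follows
-- by applying the compatibility of θ once to (a, b) and once to (b, a).
module Submission where

open import Defs
open import Level using (Level)
open import Data.Product using (_×_; _,_)
open import Data.Nat using (ℕ; zero) renaming (suc to sucℕ)
open import Data.Fin using (Fin) renaming (zero to fz; suc to fs)
open import Function using (_∘_)
open import Relation.Binary.Bundles using (Poset)
open import Relation.Binary.PropositionalEquality
  using (_≡_; refl; sym; trans; cong; cong₂; isEquivalence)

module _ {ℓ : Level} (𝐋 : CompleteResiduatedLattice ℓ) where
  open CompleteResiduatedLattice 𝐋

  ≡⇒≤ : ∀ {a b} → a ≡ b → a ≤ b
  ≡⇒≤ refl = ≤-refl

  ≤-poset : Poset ℓ ℓ ℓ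
  ≤-poset = record
    { isPartialOrder = record
      { isPreorder = record { isEquivalence = isEquivalence ; reflexive = ≡⇒≤ ; trans = ≤-trans }
      ; antisym = ≤-antisym
      }
    }

  open import Relation.Binary.Reasoning.PartialOrder ≤-poset

  𝟙≤⇒≡𝟙 : ∀ {a} → 𝟙 ≤ a → a ≡ 𝟙
  𝟙≤⇒≡𝟙 {a} = ≤-antisym (𝟙-greatest a)

  ⊗-identityˡ : ∀ a → 𝟙 ⊗ a ≡ a
  ⊗-identityˡ a = trans (⊗-comm 𝟙 a) (⊗-identityʳ a)

  ⊗-swapʳ : ∀ a b c → (a ⊗ b) ⊗ c ≡ (a ⊗ c) ⊗ b
  ⊗-swapʳ a b c = begin-equality
    (a ⊗ b) ⊗ c  ≡⟨ ⊗-assoc a b c ⟩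
    a ⊗ (b ⊗ c)  ≡⟨ cong (a ⊗_) (⊗-comm b c) ⟩
    a ⊗ (c ⊗ b)  ≡⟨ sym (⊗-assoc a c b) ⟩
    (a ⊗ c) ⊗ b  ∎

  ⊗-monoˡ-≤ : ∀ {a b} c → a ≤ b → a ⊗ c ≤ b ⊗ c
  ⊗-monoˡ-≤ c a≤b = adj₂ (≤-trans a≤b (adj₁ ≤-refl))

  ⊗-mono-≤ : ∀ {a b c d} → a ≤ b → c ≤ d → a ⊗ c ≤ b ⊗ d
  ⊗-mono-≤ {a} {b} {c} {d} a≤b c≤d = begin
    a ⊗ c  ≤⟨ ⊗-monoˡ-≤ c a≤b ⟩
    b ⊗ c  ≡⟨ ⊗-comm b c ⟩
    c ⊗ b  ≤⟨ ⊗-monoˡ-≤ b c≤d ⟩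
    d ⊗ b  ≡⟨ ⊗-comm d b ⟩
    b ⊗ d  ∎

  ∧-comm : ∀ a b → a ∧ b ≡ b ∧ a
  ∧-comm a b = ≤-antisym (∧-greatest (∧-lower₂ a b) (∧-lower₁ a b))
                         (∧-greatest (∧-lower₂ b a) (∧-lower₁ b a))

  ∧≡𝟙⇒ˡ : ∀ {a b} → a ∧ b ≡ 𝟙 → a ≡ 𝟙
  ∧≡𝟙⇒ˡ {a} {b} a∧b≡𝟙 = 𝟙≤⇒≡𝟙 (≤-trans (≡⇒≤ (sym a∧b≡𝟙)) (∧-lower₁ a b))

  ∧≡𝟙⇒ʳ : ∀ {a b} → a ∧ b ≡ 𝟙 → b ≡ 𝟙
  ∧≡𝟙⇒ʳ {a} {b} a∧b≡𝟙 = 𝟙≤⇒≡𝟙 (≤-trans (≡⇒≤ (sym a∧b≡𝟙)) (∧-lower₂ a b))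

  ∧-≡𝟙 : ∀ {a b} → a ≡ 𝟙 → b ≡ 𝟙 → a ∧ b ≡ 𝟙
  ∧-≡𝟙 refl refl = 𝟙≤⇒≡𝟙 (∧-greatest ≤-refl ≤-refl)

  big⊗-mono-≤ : ∀ {n} (x y : Fin n → L) → (∀ i → x i ≤ y i) → big⊗ 𝐋 x ≤ big⊗ 𝐋 y
  big⊗-mono-≤ {zero}   x y x≤y = ≤-refl
  big⊗-mono-≤ {sucℕ n} x y x≤y = ⊗-mono-≤ (x≤y fz) (big⊗-mono-≤ (x ∘ fs) (y ∘ fs) (x≤y ∘ fs))

  big⊗-≡𝟙 : ∀ {n} {x : Fin n → L} → (∀ i → x i ≡ 𝟙) → big⊗ 𝐋 x ≡ 𝟙
  big⊗-≡𝟙 {zero}   x≡𝟙 = refl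
  big⊗-≡𝟙 {sucℕ n} x≡𝟙 = trans (cong₂ _⊗_ (x≡𝟙 fz) (big⊗-≡𝟙 (x≡𝟙 ∘ fs))) (⊗-identityʳ 𝟙)

  module ⊗-Preorder {m : Level} {M : Set m} (θ : LRel 𝐋 M)
           (θ-refl : ∀ a → θ a a ≡ 𝟙)
           (θ-trans : ∀ a b c → θ a b ⊗ θ b c ≤ θ a c) where

    θ≈ : LRel 𝐋 M
    θ≈ = _∩_ 𝐋 θ (_⁻¹ 𝐋 θ)

    _≐_ : M → M → Set ℓ
    a ≐ b = θ≈ a b ≡ 𝟙

    θ-antitoneˡ : ∀ {a a' b} → θ a' a ≡ 𝟙 → θ a b ≤ θ a' b
    θ-antitoneˡ {a} {a'} {b} θa'a≡𝟙 = begin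
      θ a b           ≡⟨ sym (⊗-identityˡ (θ a b)) ⟩
      𝟙 ⊗ θ a b       ≡⟨ cong (_⊗ θ a b) (sym θa'a≡𝟙) ⟩
      θ a' a ⊗ θ a b  ≤⟨ θ-trans a' a b ⟩
      θ a' b          ∎

    θ-monotoneʳ : ∀ {a b b'} → θ b b' ≡ 𝟙 → θ a b ≤ θ a b'
    θ-monotoneʳ {a} {b} {b'} θbb'≡𝟙 = begin
      θ a b           ≡⟨ sym (⊗-identityʳ (θ a b)) ⟩
      θ a b ⊗ 𝟙       ≡⟨ cong (θ a b ⊗_) (sym θbb'≡𝟙) ⟩
      θ a b ⊗ θ b b'  ≤⟨ θ-trans a b b' ⟩
      θ a b'          ∎

    θ-trans-𝟙 : ∀ {a b c} → θ a b ≡ 𝟙 → θ b c ≡ 𝟙 → θ a c ≡ 𝟙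
    θ-trans-𝟙 θab≡𝟙 θbc≡𝟙 = 𝟙≤⇒≡𝟙 (≤-trans (≡⇒≤ (sym θbc≡𝟙)) (θ-antitoneˡ θab≡𝟙))

    θ≈-sym : ∀ a b → θ≈ a b ≡ θ≈ b a
    θ≈-sym a b = ∧-comm (θ a b) (θ b a)

    θ≈-trans : ∀ a b c → θ≈ a b ⊗ θ≈ b c ≤ θ≈ a c
    θ≈-trans a b c = ∧-greatest
      (≤-trans (⊗-mono-≤ (∧-lower₁ _ _) (∧-lower₁ _ _)) (θ-trans a b c))
      (begin
        θ≈ a b ⊗ θ≈ b c  ≤⟨ ⊗-mono-≤ (∧-lower₂ _ _) (∧-lower₂ _ _) ⟩
        θ b a ⊗ θ c b    ≡⟨ ⊗-comm (θ b a) (θ c b) ⟩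
        θ c b ⊗ θ b a    ≤⟨ θ-trans c b a ⟩
        θ c a            ∎)

    ≐-refl : ∀ a → a ≐ a
    ≐-refl a = ∧-≡𝟙 (θ-refl a) (θ-refl a)

    ≐-sym : ∀ {a b} → a ≐ b → b ≐ a
    ≐-sym {a} {b} = trans (θ≈-sym b a)

    ≐-trans : ∀ {a b c} → a ≐ b → b ≐ c → a ≐ c
    ≐-trans a≐b b≐c = ∧-≡𝟙 (θ-trans-𝟙 (∧≡𝟙⇒ˡ a≐b) (∧≡𝟙⇒ˡ b≐c))
                           (θ-trans-𝟙 (∧≡𝟙⇒ʳ b≐c) (∧≡𝟙⇒ʳ a≐b))

    θ-resp-≐ : ∀ {a a' b b'} → a ≐ a' → b ≐ b' → θ a b ≡ θ a' b'
    θ-resp-≐ a≐a' b≐b' = ≤-antisym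
      (≤-trans (θ-antitoneˡ (∧≡𝟙⇒ʳ a≐a')) (θ-monotoneʳ (∧≡𝟙⇒ˡ b≐b')))
      (≤-trans (θ-antitoneˡ (∧≡𝟙⇒ˡ a≐a')) (θ-monotoneʳ (∧≡𝟙⇒ʳ b≐b')))

    θ≈-resp-≐ : ∀ {a a' b b'} → a ≐ a' → b ≐ b' → θ≈ a b ≡ θ≈ a' b'
    θ≈-resp-≐ a≐a' b≐b' = cong₂ _∧_ (θ-resp-≐ a≐a' b≐b') (θ-resp-≐ b≐b' a≐a')

    θ-ext : ∀ a₁ a₂ b₁ b₂ → θ≈ a₁ b₁ ⊗ θ≈ a₂ b₂ ≤ (θ a₁ a₂ ⇒ θ b₁ b₂)
    θ-ext a₁ a₂ b₁ b₂ = adj₁ (begin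
      (θ≈ a₁ b₁ ⊗ θ≈ a₂ b₂) ⊗ θ a₁ a₂  ≤⟨ ⊗-monoˡ-≤ _ (⊗-mono-≤ (∧-lower₂ _ _) (∧-lower₁ _ _)) ⟩
      (θ b₁ a₁ ⊗ θ a₂ b₂) ⊗ θ a₁ a₂    ≡⟨ ⊗-swapʳ _ _ _ ⟩
      (θ b₁ a₁ ⊗ θ a₁ a₂) ⊗ θ a₂ b₂    ≤⟨ ⊗-monoˡ-≤ _ (θ-trans b₁ a₁ a₂) ⟩
      θ b₁ a₂ ⊗ θ a₂ b₂                ≤⟨ θ-trans b₁ a₂ b₂ ⟩
      θ b₁ b₂                          ∎)

    module _ {n : ℕ} (g : (Fin n → M) → M)
             (θ-compat : ∀ a b → big⊗ 𝐋 (λ i → θ (a i) (b i)) ≤ θ (g a) (g b)) where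

      θ≈-compat : ∀ a b → big⊗ 𝐋 (λ i → θ≈ (a i) (b i)) ≤ θ≈ (g a) (g b)
      θ≈-compat a b = ∧-greatest
        (≤-trans (big⊗-mono-≤ _ (λ i → θ (a i) (b i)) (λ i → ∧-lower₁ _ _)) (θ-compat a b))
        (≤-trans (big⊗-mono-≤ _ (λ i → θ (b i) (a i)) (λ i → ∧-lower₂ _ _)) (θ-compat b a))

      ≐-cong : ∀ {a b} → (∀ i → a i ≐ b i) → g a ≐ g b
      ≐-cong {a} {b} a≐b =
        𝟙≤⇒≡𝟙 (≤-trans (≡⇒≤ (sym (big⊗-≡𝟙 a≐b))) (θ≈-compat a b))

  compatibleLPreorder-refl : ∀ {F m} {𝐌 : AlgebraWithLOrder 𝐋 F m} {θ} →
    IsCompatibleLPreorder 𝐋 𝐌 θ → ∀ a → θ a a ≡ 𝟙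
  compatibleLPreorder-refl {𝐌 = 𝐌} C a =
    𝟙≤⇒≡𝟙 (≤-trans (≡⇒≤ (sym (AlgebraWithLOrder.≼-refl 𝐌 a)))
                   (IsCompatibleLPreorder.≼⊆θ C a a))

mainTheorem3 : ∀ {ℓ m : Level} (𝐋 : CompleteResiduatedLattice ℓ) (F : Type)
    (𝐌 : AlgebraWithLOrder 𝐋 F m) (θ : LRel 𝐋 (AlgebraWithLOrder.M 𝐌)) →
    IsCompatibleLPreorder 𝐋 𝐌 θ →
    let open Quotient 𝐋 𝐌 θ in
    (∀ {a a' b b'} → a ≐θ a' → b ≐θ b' → (a ≼θ b) ≡ (a' ≼θ b'))
    × IsAlgebraWithLOrderEq 𝐋 F (AlgebraWithLOrder.M 𝐌) _≐θ_ opθ _≈θ_ _≼θ_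
mainTheorem3 𝐋 F 𝐌 θ C = θ-resp-≐ , record
  { ≐-refl    = ≐-refl
  ; ≐-sym     = ≐-sym
  ; ≐-trans   = ≐-trans
  ; op-cong   = λ f a b → ≐-cong (op f) (θ-compat f)
  ; ≈-wd      = θ≈-resp-≐
  ; ≼-wd      = θ-resp-≐
  ; ≈-one⇒≐   = λ _ _ a≐b → a≐b
  ; ≐⇒≈-one   = λ _ _ a≐b → a≐b
  ; ≈-sym     = θ≈-sym
  ; ≈-trans   = θ≈-trans
  ; ≈-compat  = λ f → θ≈-compat (op f) (θ-compat f)
  ; ≼-refl    = θ-refl
  ; ≼-antisym = λ _ _ → ≤-refl
  ; ≼-trans   = θ-trans
  ; ≼-ext     = θ-ext
  ; ≼-compat  = θ-compat
  }
  where
    open CompleteResiduatedLattice 𝐋 using (𝟙; ≤-refl)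
    open AlgebraWithLOrder 𝐌 using (op)
    open IsCompatibleLPreorder C using (θ-trans; θ-compat)
    θ-refl : ∀ a → θ a a ≡ 𝟙
    θ-refl = compatibleLPreorder-refl 𝐋 C
    open ⊗-Preorder 𝐋 θ θ-refl θ-trans
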